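{- Let $\Pi_q$ be a projective plane of order $q$ and $r$ a positive integer with $\binom{r}{2}\le q$. Let $A$ be a set of points and $i\ge 0$ an integer. If $A^i$ contains all points of $r$ distinct lines, then $A^{i+1}$ is the whole point set of $\Pi_q$.
   Context: A finite projective plane $\Pi_q$ of order $q\ge 2$ has $q^2+q+1$ points and $q^2+q+1$ lines; every line contains $q+1$ points, every point lies on $q+1$ lines, any two lines meet in exactly one point and any two points lie on exactly one line. $r$-neighbor line percolation: for a set $A$ of points let $A^0=A$ and for $s\ge1$ let $A^s=A^{s-1}\cup\{P: \exists \text{ line } l\ni P \text{ with } |l\cap A^{s-1}|\ge r\}$. -}

module Defs where

open import Data.Nat using (ℕ; zero; suc; _+_; _*_; _≤_; _≤ᵇ_)
open import Data.Nat.Combinatorics using (_C_)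
open import Data.Fin using (Fin)
open import Data.Bool using (Bool; true; false; _∧_; _∨_; if_then_else_)
open import Data.List using (List; filter; length)
open import Data.Bool.ListAction using (any)
open import Data.List.Base using (allFin)
open import Data.Product using (Σ; ∃; _×_; _,_)
open import Relation.Binary.PropositionalEquality using (_≡_; _≢_)
open import Relation.Nullary using (¬_)
open import Relation.Nullary.Decidable using (does)
open import Data.Bool using (T)

count : {n : ℕ} → (Fin n → Bool) → ℕ
count {n} f = length (filter (λ i → Data.Bool._≟_ (f i) true) (allFin n))

size : ℕ → ℕ
size q = q * q + q + 1

record ProjectivePlane (q : ℕ) : Set where
  field
    _I_ : Fin (size q) → Fin (size q) → Bool   -- point I line
    line-size   : ∀ l → count (λ P → P I l) ≡ suc q
    point-deg   : ∀ P → count (λ l → P I l) ≡ suc q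
    lines-meet  : ∀ l m → l ≢ m →
                  Σ (Fin (size q)) λ P → T (P I l) × T (P I m) ×
                    (∀ Q → T (Q I l) → T (Q I m) → Q ≡ P)
    points-join : ∀ P Q → P ≢ Q →
                  Σ (Fin (size q)) λ l → T (P I l) × T (Q I l) ×
                    (∀ m → T (P I m) → T (Q I m) → m ≡ l)

module _ {q : ℕ} (Π : ProjectivePlane q) where
  open ProjectivePlane Π

  PointSet : Set
  PointSet = Fin (size q) → Bool

  lineCount : PointSet → Fin (size q) → ℕ
  lineCount A l = count (λ P → (P I l) ∧ A P)

  step : ℕ → PointSet → PointSet
  step r A P = A P ∨ any (λ l → (P I l) ∧ (r ≤ᵇ lineCount A l)) (allFin (size q))

  perc : ℕ → PointSet → ℕ → PointSet
  perc r A zero    = A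
  perc r A (suc s) = step r (perc r A s)

  ContainsLine : PointSet → Fin (size q) → Set
  ContainsLine A l = ∀ P → T (P I l) → T (A P)

-- Let P be a point on none of the r full lines L₀,…,L_{r-1}. The lines through P
-- number q+1, and each of the at most C(r,2) intersection points Lᵢ ∩ Lⱼ lies on
-- exactly one of them. Since C(r,2) ≤ q, some line m through P avoids all these
-- points, so m meets the r lines in r distinct points of Aⁱ and P ∈ Aⁱ⁺¹.
module Submission where

open import Defs
open import Data.Nat using (ℕ; suc; _≤_)
open import Data.Nat.Combinatorics using (_C_)
open import Data.Fin using (Fin)
open import Data.Bool using (T)
open import Function.Definitions using (Injective)
open import Relation.Binary.PropositionalEquality using (_≡_)

open import Data.Bool using (Bool; true; false; _∧_; _∨_; not; if_then_else_)
  renaming (_≟_ to _≟ᵇ_)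
open import Data.Bool.Properties using (T-∧; T-∨; ∧-distribˡ-∨)
open import Data.Fin using (zero; suc; _≟_)
open import Data.Fin.Properties using (any?; suc-injective)
open import Data.List using (filter; length; tabulate)
open import Data.List.Membership.Propositional using (lose)
open import Data.List.Membership.Propositional.Properties using (∈-allFin)
open import Data.List.Relation.Unary.Any.Properties using (any⁺)
open import Data.Nat using (zero; _+_; _<_; z≤n; s≤s)
open import Data.Nat.Properties
  using (≤-trans; ≤-reflexive; <-≤-trans; ≤⇒≤ᵇ; m≤n⇒m≤1+n; n≤1+n; +-suc; +-mono-≤; +-monoʳ-≤; <⇒≱)
open import Data.Nat.Combinatorics using (nCk+nC[k+1]≡[n+1]C[k+1]; nC1≡n)
open import Data.Product using (∃; _×_; _,_; proj₁; proj₂)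
open import Data.Sum using (inj₁; inj₂)
open import Data.Empty using (⊥-elim)
open import Function using (_∘_; Equivalence)
open import Relation.Nullary using (¬_; yes; no; does)
open import Relation.Nullary.Decidable using (T?; ¬?; _×-dec_; decidable-stable; dec-true; dec-false)
open import Relation.Binary.PropositionalEquality using (refl; sym; trans; cong; subst; _≢_)

open Equivalence using (to; from)

private
  variable
    n r : ℕ

count-tabulate : ∀ {m} (g : Fin n → Fin m) (f : Fin m → Bool) →
  length (filter (λ i → f i ≟ᵇ true) (tabulate g)) ≡ count (f ∘ g)
count-tabulate {zero}  g f = refl
count-tabulate {suc n} g f with f (g zero)
... | true  = cong suc (trans (count-tabulate (g ∘ suc) f) (sym (count-tabulate suc (f ∘ g))))
... | false = trans (count-tabulate (g ∘ suc) f) (sym (count-tabulate suc (f ∘ g)))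

count-suc : (f : Fin (suc n) → Bool) →
  count f ≡ (if f zero then suc (count (f ∘ suc)) else count (f ∘ suc))
count-suc f with f zero | count-tabulate suc f
... | true  | eq = cong suc eq
... | false | eq = eq

count-mono : {f g : Fin n → Bool} → (∀ x → T (f x) → T (g x)) → count f ≤ count g
count-mono {zero}          _   = z≤n
count-mono {suc n} {f} {g} f⇒g rewrite count-suc f | count-suc g with f zero | g zero | f⇒g zero
... | true  | true  | _   = s≤s (count-mono (f⇒g ∘ suc))
... | true  | false | f⇒g₀ = ⊥-elim (f⇒g₀ _)
... | false | true  | _   = m≤n⇒m≤1+n (count-mono (f⇒g ∘ suc))
... | false | false | _   = count-mono (f⇒g ∘ suc)

count-none : {f : Fin n → Bool} → (∀ x → ¬ T (f x)) → count f ≡ 0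
count-none {zero}      _  = refl
count-none {suc n} {f} ¬f rewrite count-suc f with f zero | ¬f zero
... | true  | ¬f₀ = ⊥-elim (¬f₀ _)
... | false | _   = count-none (¬f ∘ suc)

count-∧-false : (f : Fin n → Bool) → count (λ x → f x ∧ false) ≡ 0
count-∧-false f = count-none (λ x → proj₂ ∘ to (T-∧ {f x}))

count≤1 : {f : Fin n → Bool} → (∀ x y → T (f x) → T (f y) → x ≡ y) → count f ≤ 1
count≤1 {zero}      _      = z≤n
count≤1 {suc n} {f} unique rewrite count-suc f with f zero in f₀
... | true  = ≤-reflexive (cong suc (count-none λ x fx → zero≢suc (unique zero (suc x) (subst T (sym f₀) _) fx)))
  where
  zero≢suc : ∀ {x : Fin n} → zero ≢ suc x
  zero≢suc ()
... | false = count≤1 (λ x y fx fy → suc-injective (unique (suc x) (suc y) fx fy))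

count-∨ : (f g : Fin n → Bool) → count (λ x → f x ∨ g x) ≤ count f + count g
count-∨ {zero}  f g = z≤n
count-∨ {suc n} f g
  rewrite count-suc (λ x → f x ∨ g x) | count-suc f | count-suc g
  with f zero | g zero | count-∨ (f ∘ suc) (g ∘ suc)
... | true  | true  | ih = s≤s (≤-trans ih (+-monoʳ-≤ (count (f ∘ suc)) (n≤1+n _)))
... | true  | false | ih = s≤s ih
... | false | true  | ih = ≤-trans (s≤s ih) (≤-reflexive (sym (+-suc _ _)))
... | false | false | ih = ih

count-∧-∨ : (f g h : Fin n → Bool) →
  count (λ x → f x ∧ (g x ∨ h x)) ≤ count (λ x → f x ∧ g x) + count (λ x → f x ∧ h x)
count-∧-∨ f g h =
  ≤-trans (count-mono (λ x → subst T (∧-distribˡ-∨ (f x) (g x) (h x)))) (count-∨ (λ x → f x ∧ g x) (λ x → f x ∧ h x))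

count-< : {f g : Fin n → Bool} (a : Fin n) →
  (∀ x → T (g x) → T (f x)) → T (f a) → ¬ T (g a) → count g < count f
count-< {suc n} {f} {g} zero g⇒f fa ¬ga
  rewrite count-suc f | count-suc g with f zero | g zero | fa | ¬ga
... | true  | false | _ | _   = s≤s (count-mono (g⇒f ∘ suc))
... | _     | true  | _ | ¬g₀ = ⊥-elim (¬g₀ _)
count-< {suc n} {f} {g} (suc a) g⇒f fa ¬ga
  rewrite count-suc f | count-suc g with f zero | g zero | g⇒f zero | count-< a (g⇒f ∘ suc) fa ¬ga
... | true  | true  | _   | lt = s≤s lt
... | true  | false | _   | lt = m≤n⇒m≤1+n lt
... | false | true  | g⇒f₀ | _ = ⊥-elim (g⇒f₀ _)
... | false | false | _   | lt = lt

count-<⇒∃ : {f g : Fin n → Bool} → count g < count f → ∃ λ x → T (f x) × ¬ T (g x)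
count-<⇒∃ {f = f} {g} g<f with any? (λ x → T? (f x) ×-dec ¬? (T? (g x)))
... | yes witness = witness
... | no  none    = ⊥-elim (<⇒≱ g<f (count-mono f⇒g))
  where
  f⇒g : ∀ x → T (f x) → T (g x)
  f⇒g x fx = decidable-stable (T? (g x)) (λ ¬gx → none (x , fx , ¬gx))

injective⇒≤count : (f : Fin n → Bool) (g : Fin r → Fin n) →
  Injective _≡_ _≡_ g → (∀ j → T (f (g j))) → r ≤ count f
injective⇒≤count {r = zero}  f g _     _  = z≤n
injective⇒≤count {r = suc r} f g g-inj fg =
  <-≤-trans (s≤s (injective⇒≤count f′ (g ∘ suc) (suc-injective ∘ g-inj) f′g))
            (count-< (g zero) (λ x → proj₁ ∘ to T-∧) (fg zero) ¬f′g₀)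
  where
  f′ : Fin _ → Bool
  f′ x = f x ∧ not (does (x ≟ g zero))
  f′g : ∀ j → T (f′ (g (suc j)))
  f′g j = from T-∧ (fg (suc j) , subst (T ∘ not) (sym (dec-false (g (suc j) ≟ g zero) g₊≢g₀)) _)
    where
    g₊≢g₀ : g (suc j) ≢ g zero
    g₊≢g₀ e with g-inj e
    ... | ()
  ¬f′g₀ : ¬ T (f′ (g zero))
  ¬f′g₀ t = subst (T ∘ not) (dec-true (g zero ≟ g zero) refl) (proj₂ (to T-∧ t))

module _ {q : ℕ} (Π : ProjectivePlane q) where
  open ProjectivePlane Π

  private
    Point Line : Set
    Point = Fin (size q)
    Line  = Fin (size q)

  lines-through-two-points≤1 : {P X : Point} → P ≢ X → count (λ m → P I m ∧ X I m) ≤ 1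
  lines-through-two-points≤1 {P} {X} P≢X = count≤1 λ m m′ t t′ →
    let P∈m , X∈m = to T-∧ t; P∈m′ , X∈m′ = to T-∧ t′; _ , _ , _ , unique = points-join P X P≢X
    in trans (unique m P∈m X∈m) (sym (unique m′ P∈m′ X∈m′))

  throughMeet : Line → Line → Line → Bool
  throughMeet l l′ m with l ≟ l′
  ... | yes _    = false
  ... | no  l≢l′ = proj₁ (lines-meet l l′ l≢l′) I m

  throughMeet-intro : ∀ {l l′ m Y} → l ≢ l′ → T (Y I l) → T (Y I l′) → T (Y I m) →
    T (throughMeet l l′ m)
  throughMeet-intro {l} {l′} {m} {Y} l≢l′ Y∈l Y∈l′ Y∈m with l ≟ l′
  ... | yes l≡l′ = ⊥-elim (l≢l′ l≡l′)
  ... | no  l≢l′ = subst (λ Z → T (Z I m)) (proj₂ (proj₂ (proj₂ (lines-meet l l′ l≢l′))) Y Y∈l Y∈l′) Y∈m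

  throughMeet-count≤1 : ∀ {P} l l′ → ¬ T (P I l) → count (λ m → P I m ∧ throughMeet l l′ m) ≤ 1
  throughMeet-count≤1 {P} l l′ P∉l with l ≟ l′
  ... | yes _    = ≤-trans (≤-reflexive (count-∧-false (P I_))) z≤n
  ... | no  l≢l′ with lines-meet l l′ l≢l′
  ...   | X , X∈l , _ = lines-through-two-points≤1 (λ P≡X → P∉l (subst (λ Z → T (Z I l)) (sym P≡X) X∈l))

  throughMeetOf : ∀ {k} → Line → (Fin k → Line) → Line → Bool
  throughMeetOf {zero}  a L m = false
  throughMeetOf {suc k} a L m = throughMeet a (L zero) m ∨ throughMeetOf a (L ∘ suc) m

  throughVertex : (Fin r → Line) → Line → Bool
  throughVertex {zero}  L m = false
  throughVertex {suc r} L m = throughMeetOf (L zero) (L ∘ suc) m ∨ throughVertex (L ∘ suc) m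

  throughMeetOf-intro : ∀ {k a m Y} (L : Fin k → Line) j → a ≢ L j →
    T (Y I a) → T (Y I L j) → T (Y I m) → T (throughMeetOf a L m)
  throughMeetOf-intro L zero    a≢L Y∈a Y∈L Y∈m = from T-∨ (inj₁ (throughMeet-intro a≢L Y∈a Y∈L Y∈m))
  throughMeetOf-intro L (suc j) a≢L Y∈a Y∈L Y∈m = from T-∨ (inj₂ (throughMeetOf-intro (L ∘ suc) j a≢L Y∈a Y∈L Y∈m))

  throughVertex-intro : ∀ {m Y} (L : Fin r → Line) → Injective _≡_ _≡_ L → ∀ {i j} → i ≢ j →
    T (Y I L i) → T (Y I L j) → T (Y I m) → T (throughVertex L m)
  throughVertex-intro L L-inj {zero}  {zero}  i≢j _ _ _ = ⊥-elim (i≢j refl)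
  throughVertex-intro L L-inj {zero}  {suc j} i≢j Y∈Li Y∈Lj Y∈m =
    from T-∨ (inj₁ (throughMeetOf-intro (L ∘ suc) j (i≢j ∘ L-inj) Y∈Li Y∈Lj Y∈m))
  throughVertex-intro L L-inj {suc i} {zero}  i≢j Y∈Li Y∈Lj Y∈m =
    from T-∨ (inj₁ (throughMeetOf-intro (L ∘ suc) i (i≢j ∘ sym ∘ L-inj) Y∈Lj Y∈Li Y∈m))
  throughVertex-intro L L-inj {suc i} {suc j} i≢j Y∈Li Y∈Lj Y∈m =
    from T-∨ (inj₂ (throughVertex-intro (L ∘ suc) (suc-injective ∘ L-inj) (i≢j ∘ cong suc) Y∈Li Y∈Lj Y∈m))

  throughMeetOf-count : ∀ {k P} a (L : Fin k → Line) → ¬ T (P I a) →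
    count (λ m → P I m ∧ throughMeetOf a L m) ≤ k
  throughMeetOf-count {zero}  {P} a L _   = ≤-reflexive (count-∧-false (P I_))
  throughMeetOf-count {suc k} {P} a L P∉a =
    ≤-trans (count-∧-∨ (P I_) (throughMeet a (L zero)) (throughMeetOf a (L ∘ suc)))
            (+-mono-≤ (throughMeet-count≤1 a (L zero) P∉a) (throughMeetOf-count a (L ∘ suc) P∉a))

  throughVertex-count : ∀ {P} (L : Fin r → Line) → (∀ j → ¬ T (P I L j)) →
    count (λ m → P I m ∧ throughVertex L m) ≤ r C 2
  throughVertex-count {zero}  {P} L _   = ≤-reflexive (count-∧-false (P I_))
  throughVertex-count {suc r} {P} L P∉L =
    ≤-trans (count-∧-∨ (P I_) (throughMeetOf (L zero) (L ∘ suc)) (throughVertex (L ∘ suc)))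
      (≤-trans (+-mono-≤ (throughMeetOf-count (L zero) (L ∘ suc) (P∉L zero))
                         (throughVertex-count (L ∘ suc) (P∉L ∘ suc)))
               (≤-reflexive pascal))
    where
    pascal : r + r C 2 ≡ suc r C 2
    pascal = trans (cong (_+ r C 2) (sym (nC1≡n r))) (nCk+nC[k+1]≡[n+1]C[k+1] r 1)

  line-avoiding-vertices : ∀ {P} (L : Fin r → Line) → (∀ j → ¬ T (P I L j)) → r C 2 ≤ q →
    ∃ λ m → T (P I m) × ¬ T (throughVertex L m)
  line-avoiding-vertices {r} {P} L P∉L r₂≤q =
    let m , P∈m , ¬bad = count-<⇒∃ few in m , P∈m , λ bad → ¬bad (from T-∧ (P∈m , bad))
    where
    few : count (λ m → P I m ∧ throughVertex L m) < count (P I_)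
    few = ≤-trans (s≤s (≤-trans (throughVertex-count L P∉L) r₂≤q)) (≤-reflexive (sym (point-deg P)))

  avoids-vertices⇒rich : ∀ {B m} (L : Fin r → Line) → Injective _≡_ _≡_ L →
    (∀ j → ContainsLine Π B (L j)) → (∀ j → m ≢ L j) → ¬ T (throughVertex L m) →
    r ≤ lineCount Π B m
  avoids-vertices⇒rich {B = B} {m} L L-inj L⊆B m≢L ¬bad =
    injective⇒≤count (λ P → P I m ∧ B P) Y Y-inj (λ j → from T-∧ (Y∈m j , L⊆B j (Y j) (Y∈L j)))
    where
    Y : Fin _ → Point
    Y j = proj₁ (lines-meet m (L j) (m≢L j))
    Y∈m : ∀ j → T (Y j I m)
    Y∈m j = proj₁ (proj₂ (lines-meet m (L j) (m≢L j)))
    Y∈L : ∀ j → T (Y j I L j)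
    Y∈L j = proj₁ (proj₂ (proj₂ (lines-meet m (L j) (m≢L j))))
    Y-inj : Injective _≡_ _≡_ Y
    Y-inj {i} {j} Yi≡Yj with i ≟ j
    ... | yes i≡j = i≡j
    ... | no  i≢j = ⊥-elim (¬bad (throughVertex-intro L L-inj i≢j
                      (Y∈L i) (subst (λ Z → T (Z I L j)) (sym Yi≡Yj) (Y∈L j)) (Y∈m i)))

  step-⊇ : ∀ {B P} → T (B P) → T (step Π r B P)
  step-⊇ P∈B = from T-∨ (inj₁ P∈B)

  step-rich-line : ∀ {B P m} → T (P I m) → r ≤ lineCount Π B m → T (step Π r B P)
  step-rich-line {m = m} P∈m rich =
    from T-∨ (inj₂ (any⁺ _ (lose (∈-allFin m) (from T-∧ (P∈m , ≤⇒≤ᵇ rich)))))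

  step-covers : ∀ {B} (L : Fin r → Line) → Injective _≡_ _≡_ L → r C 2 ≤ q →
    (∀ j → ContainsLine Π B (L j)) → ∀ P → T (step Π r B P)
  step-covers {r} {B} L L-inj r₂≤q L⊆B P with any? (λ j → T? (P I L j))
  ... | yes (j , P∈Lj) = step-⊇ {r = r} {B} (L⊆B j P P∈Lj)
  ... | no  P∉L =
    let m , P∈m , ¬bad = line-avoiding-vertices L P∉Lj r₂≤q
        m≢L j m≡Lj = P∉Lj j (subst (λ l → T (P I l)) m≡Lj P∈m)
    in step-rich-line P∈m (avoids-vertices⇒rich L L-inj L⊆B m≢L ¬bad)
    where
    P∉Lj : ∀ j → ¬ T (P I L j)
    P∉Lj j P∈Lj = P∉L (j , P∈Lj)

proposition4 : (q : ℕ) → 2 ≤ q → (Π : ProjectivePlane q) →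
    (r : ℕ) → 1 ≤ r → r C 2 ≤ q →
    (A : PointSet Π) → (i : ℕ) →
    (L : Fin r → Fin (size q)) → Injective _≡_ _≡_ L →
    (∀ j → ContainsLine Π (perc Π r A i) (L j)) →
    ∀ P → T (perc Π r A (suc i) P)
proposition4 q _ Π r _ r₂≤q A i L L-inj L⊆Aⁱ = step-covers Π L L-inj r₂≤q L⊆Aⁱ
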